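{- Let $\mathcal{M}=\langle M,\mathcal{I}^{\mathcal{M}},\sqsubseteq^{\mathcal{M}}\rangle$ be a model of $\mathrm{IABA}_{\mathrm{Ideal}}$, let $A$ be the set of atoms of $\langle M,\sqsubseteq^{\mathcal{M}}\rangle$, and let $f:\mathcal{I}^{\mathcal{M}}\to A$ be a bijection. Define $\in^*\subseteq M\times M$ by $x\in^*y$ iff $x\in\mathcal{I}^{\mathcal{M}}$ and $f(x)\sqsubseteq^{\mathcal{M}}y$. Then $\langle M,\mathcal{I}^{\mathcal{M}},\in^*\rangle\models\mathrm{BAC}^+$ (with $\mathcal{I}^{\mathcal{M}}$ interpreting $\mathcal{S}$) and its subset relation equals $\sqsubseteq^{\mathcal{M}}$.
   Context: $\mathrm{IABA}$ is the theory of infinite atomic Boolean algebras in $\{\sqsubseteq\}$ (distributive complemented lattice order with $0$, $1$, every nonzero element above an atom, infinitely many atoms; complement $\dotminus$, meet $\dot\land$). $\mathrm{IABA}_{\mathrm{Ideal}}$ is the theory in $\{\sqsubseteq,\mathcal{I}\}$ extending $\mathrm{IABA}$ with: $\mathcal{I}$ is a proper ideal (contains $0$, not $1$, closed under binary joins, downward closed); for each $n\in\mathbb{N}$, every element with at most $n$ atoms below it is in $\mathcal{I}$; and $\forall x(\neg\mathcal{I}(x)\Rightarrow\exists y(y\sqsubseteq x\land\neg\mathcal{I}(y)\land\neg\mathcal{I}(x\dot\land\dotminus y)))$. $\mathcal{L}_{cl}$ has binary $\in$ and unary $\mathcal{S}$; elements satisfying $\mathcal{S}$ are sets, all elements classes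 (lowercase variables over sets, uppercase over classes). $\mathrm{BAC}$ has axioms: (Mem) if $X\in Y$ then $X$ is a set; (Subset) if $x$ is a set and every set in $X$ is in $x$ then $X$ is a set; (Emp) there is a set with no set members; (Adj) for sets $x,y$ there is a set whose set members are exactly those of $x$ together with $y$; (CExt) classes with the same set members are equal; (Union) for sets $x,y$ there is a set whose set members are those in $x$ or $y$; (UB) for every set $x$ there is a set $y\notin x$; (CUnion),(CIntersection) closure of classes under union and intersection; (CComp) every class has a complement class (relative to the sets). $\mathrm{BAC}^+$ is $\mathrm{BAC}$ plus (Sep): for every class $X$ that is not a set there is a class $Y\subseteq X$ such that neither $Y$ nor $X\setminus Y$ is a set. The subset relation: $X\subseteq Y$ iff every set member of $X$ is a member of $Y$. -}

module Defs where

open import Level using (0ℓ)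
open import Data.Nat using (ℕ)
open import Data.Fin using (Fin)
open import Data.Product using (Σ; ∃; _×_; _,_)
open import Data.Sum using (_⊎_)
open import Relation.Nullary using (¬_)
open import Relation.Binary.PropositionalEquality using (_≡_; _≢_)
open import Function.Definitions using (Injective)

_iff_ : Set → Set → Set
A iff B = (A → B) × (B → A)

infix 2 _iff_

-- The lattice operations are the meets,
-- joins, bottom, top and complements determined by ⊑; we carry them as
-- functions characterised by their universal properties w.r.t. ⊑.

record IABA : Set₁ where
  field
    M     : Set
    _⊑_   : M → M → Set
    ⊑-refl    : ∀ x → x ⊑ x
    ⊑-trans   : ∀ {x y z} → x ⊑ y → y ⊑ z → x ⊑ z
    ⊑-antisym : ∀ {x y} → x ⊑ y → y ⊑ x → x ≡ y
    _∧_   : M → M → M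
    ∧-lb₁ : ∀ x y → (x ∧ y) ⊑ x
    ∧-lb₂ : ∀ x y → (x ∧ y) ⊑ y
    ∧-glb : ∀ {x y z} → z ⊑ x → z ⊑ y → z ⊑ (x ∧ y)
    _∨_   : M → M → M
    ∨-ub₁ : ∀ x y → x ⊑ (x ∨ y)
    ∨-ub₂ : ∀ x y → y ⊑ (x ∨ y)
    ∨-lub : ∀ {x y z} → x ⊑ z → y ⊑ z → (x ∨ y) ⊑ z
    𝟘 : M
    𝟙 : M
    𝟘-least : ∀ x → 𝟘 ⊑ x
    𝟙-great : ∀ x → x ⊑ 𝟙
    distrib : ∀ x y z → (x ∧ (y ∨ z)) ⊑ ((x ∧ y) ∨ (x ∧ z))
    ∸_     : M → M
    compl-∧ : ∀ x → (x ∧ (∸ x)) ≡ 𝟘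
    compl-∨ : ∀ x → (x ∨ (∸ x)) ≡ 𝟙

  Atom : M → Set
  Atom a = (a ≢ 𝟘) × (∀ y → y ⊑ a → (y ≡ 𝟘) ⊎ (y ≡ a))

  field
    atomic : ∀ x → x ≢ 𝟘 → Σ M (λ a → Atom a × (a ⊑ x))
    infinite : ∀ (n : ℕ) → Σ (Fin n → M) (λ g → Injective _≡_ _≡_ g × (∀ i → Atom (g i)))

record IABAIdeal : Set₁ where
  field
    ba : IABA
  open IABA ba public
  field
    I : M → Set
    I-𝟘    : I 𝟘
    I-¬𝟙   : ¬ I 𝟙
    I-∨    : ∀ x y → I x → I y → I (x ∨ y)
    I-down : ∀ x y → y ⊑ x → I x → I y
    I-finite : ∀ (n : ℕ) (x : M) (g : Fin n → M) →
               (∀ a → Atom a → a ⊑ x → Σ (Fin n) (λ i → a ≡ g i)) → I x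
    I-split : ∀ x → ¬ I x → Σ M (λ y → (y ⊑ x) × (¬ I y) × (¬ I (x ∧ (∸ y))))

module ClassTheory (D : Set) (S : D → Set) (_∈_ : D → D → Set) where

  _⊆_ : D → D → Set
  X ⊆ Y = ∀ z → S z → z ∈ X → z ∈ Y

  Mem = ∀ X Y → X ∈ Y → S X
  SubsetAx = ∀ x X → S x → (∀ z → S z → z ∈ X → z ∈ x) → S X
  Emp = Σ D (λ x → S x × (∀ z → S z → ¬ (z ∈ x)))
  Adj = ∀ x y → S x → S y →
          Σ D (λ w → S w × (∀ z → S z → (z ∈ w) iff ((z ∈ x) ⊎ (z ≡ y))))
  CExt = ∀ X Y → (∀ z → S z → (z ∈ X) iff (z ∈ Y)) → X ≡ Y
  UnionAx = ∀ x y → S x → S y →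
          Σ D (λ w → S w × (∀ z → S z → (z ∈ w) iff ((z ∈ x) ⊎ (z ∈ y))))
  UB = ∀ x → S x → Σ D (λ y → S y × ¬ (y ∈ x))
  CUnion = ∀ X Y → Σ D (λ Z → ∀ z → S z → (z ∈ Z) iff ((z ∈ X) ⊎ (z ∈ Y)))
  CIntersection = ∀ X Y → Σ D (λ Z → ∀ z → S z → (z ∈ Z) iff ((z ∈ X) × (z ∈ Y)))
  CComp = ∀ X → Σ D (λ Y → ∀ z → S z → (z ∈ Y) iff ¬ (z ∈ X))
  Sep = ∀ X → ¬ S X →
          Σ D (λ Y → Σ D (λ W → (Y ⊆ X)
            × (∀ z → S z → (z ∈ W) iff ((z ∈ X) × ¬ (z ∈ Y)))
            × ¬ S Y × ¬ S W))

  record BAC : Set where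
    field
      mem : Mem
      subset : SubsetAx
      emp : Emp
      adj : Adj
      cext : CExt
      union : UnionAx
      ub : UB
      cunion : CUnion
      cintersection : CIntersection
      ccomp : CComp

  record BAC⁺ : Set where
    field
      bac : BAC
      sep : Sep

module _ (𝓜 : IABAIdeal) where
  open IABAIdeal 𝓜

  -- f : I → A is a bijection (f is given as a function on M whose values
  -- outside I are irrelevant)
  IsBijectionIA : (M → M) → Set
  IsBijectionIA f =
      (∀ x → I x → Atom (f x))
    × (∀ x y → I x → I y → f x ≡ f y → x ≡ y)
    × (∀ a → Atom a → Σ M (λ x → I x × (f x ≡ a)))

  _∈*[_]_ : M → (M → M) → M → Set
  x ∈*[ f ] y = I x × (f x ⊑ y)

-- Under ∈*, the members of y are the preimages under f of the atoms below y.
-- As the algebra is atomic, an element is determined by the atoms below it,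
-- so ⊆ coincides with ⊑ and the Boolean operations ∨, ∧, ∸ realise union,
-- intersection and complement of classes. Sets are the elements of the ideal:
-- the Boolean join of a set with an atom stays in I (Adj), the complement of
-- a set is nonzero and so contains an atom not in it (UB), and the splitting
-- axiom of I is literally Sep.
{-# OPTIONS --safe #-}
module Submission where

open import Defs
open import Axiom.ExcludedMiddle using (ExcludedMiddle)
open import Level using (0ℓ)
open import Data.Product using (_×_; _,_; proj₁; proj₂; Σ)
open import Data.Product.Base as Product using ()
open import Data.Sum using (_⊎_; inj₁; inj₂)
open import Data.Sum.Base as Sum using ()
open import Data.Empty using (⊥-elim)
open import Data.Fin using (Fin)
open import Relation.Nullary using (¬_; yes; no)
open import Relation.Binary.PropositionalEquality using (_≡_; _≢_; refl; sym; subst)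

iff-refl : ∀ {A : Set} → A iff A
iff-refl = (λ a → a) , (λ a → a)

iff-trans : ∀ {A B C : Set} → A iff B → B iff C → A iff C
iff-trans (f , g) (h , k) = (λ a → h (f a)) , (λ c → g (k c))

⊎-cong-iff : ∀ {A B C D : Set} → A iff B → C iff D → (A ⊎ C) iff (B ⊎ D)
⊎-cong-iff (f , g) (h , k) = Sum.map f h , Sum.map g k

×-cong-iff : ∀ {A B C D : Set} → A iff B → C iff D → (A × C) iff (B × D)
×-cong-iff (f , g) (h , k) = Product.map f h , Product.map g k

module AtomicBooleanAlgebra (𝓑 : IABA) where
  open IABA 𝓑

  ≡⇒⊑ : ∀ {x y} → x ≡ y → x ⊑ y
  ≡⇒⊑ {x} refl = ⊑-refl x

  ⊑-∧-∨-∧∸ : ∀ x u → x ⊑ ((x ∧ u) ∨ (x ∧ (∸ u)))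
  ⊑-∧-∨-∧∸ x u =
    ⊑-trans (∧-glb (⊑-refl x) (subst (x ⊑_) (sym (compl-∨ u)) (𝟙-great x)))
            (distrib x u (∸ u))

  ∧≡𝟘⇒⊑∸ : ∀ x u → (x ∧ u) ≡ 𝟘 → x ⊑ (∸ u)
  ∧≡𝟘⇒⊑∸ x u e =
    ⊑-trans (⊑-∧-∨-∧∸ x u)
            (∨-lub (subst (_⊑ (∸ u)) (sym e) (𝟘-least _)) (∧-lb₂ x (∸ u)))

  ∧∸≡𝟘⇒⊑ : ∀ x u → (x ∧ (∸ u)) ≡ 𝟘 → x ⊑ u
  ∧∸≡𝟘⇒⊑ x u e =
    ⊑-trans (⊑-∧-∨-∧∸ x u)
            (∨-lub (∧-lb₂ x u) (subst (_⊑ u) (sym e) (𝟘-least _)))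

  ⊑-∸-both⇒≡𝟘 : ∀ {x u} → x ⊑ u → x ⊑ (∸ u) → x ≡ 𝟘
  ⊑-∸-both⇒≡𝟘 {x} {u} p q = ⊑-antisym (subst (x ⊑_) (compl-∧ u) (∧-glb p q)) (𝟘-least x)

  atom⊑⊎atom⊑∸ : ∀ {a} u → Atom a → (a ⊑ u) ⊎ (a ⊑ (∸ u))
  atom⊑⊎atom⊑∸ {a} u (_ , below-a) with below-a (a ∧ u) (∧-lb₁ a u)
  ... | inj₁ a∧u≡𝟘 = inj₂ (∧≡𝟘⇒⊑∸ a u a∧u≡𝟘)
  ... | inj₂ a∧u≡a = inj₁ (subst (_⊑ u) a∧u≡a (∧-lb₂ a u))

  atom⊑∸⇔atom⋢ : ∀ {a} u → Atom a → (a ⊑ (∸ u)) iff ¬ (a ⊑ u)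
  atom⊑∸⇔atom⋢ u (a≢𝟘 , _) .proj₁ q p = a≢𝟘 (⊑-∸-both⇒≡𝟘 p q)
  atom⊑∸⇔atom⋢ u at .proj₂ a⋢u = Sum.[ (λ p → ⊥-elim (a⋢u p)) , (λ q → q) ] (atom⊑⊎atom⊑∸ u at)

  atom⊑∨ : ∀ {a} u v → Atom a → a ⊑ (u ∨ v) → (a ⊑ u) ⊎ (a ⊑ v)
  atom⊑∨ {a} u v at p with atom⊑⊎atom⊑∸ u at | atom⊑⊎atom⊑∸ v at
  ... | inj₁ a⊑u | _        = inj₁ a⊑u
  ... | _        | inj₁ a⊑v = inj₂ a⊑v
  ... | inj₂ a⊑∸u | inj₂ a⊑∸v = ⊥-elim (proj₁ at (⊑-antisym a⊑𝟘 (𝟘-least a)))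
    where
    disjoint : ∀ w → a ⊑ (∸ w) → (a ∧ w) ⊑ 𝟘
    disjoint w q = ≡⇒⊑ (⊑-∸-both⇒≡𝟘 (∧-lb₂ a w) (⊑-trans (∧-lb₁ a w) q))

    a⊑𝟘 : a ⊑ 𝟘
    a⊑𝟘 = ⊑-trans (⊑-trans (∧-glb (⊑-refl a) p) (distrib a u v))
                  (∨-lub (disjoint u a⊑∸u) (disjoint v a⊑∸v))

  ⊑-by-atoms : ExcludedMiddle 0ℓ → ∀ x y →
               (∀ a → Atom a → a ⊑ x → a ⊑ y) → x ⊑ y
  ⊑-by-atoms em x y atoms⊑ with em {(x ∧ (∸ y)) ≡ 𝟘}
  ... | yes e = ∧∸≡𝟘⇒⊑ x y e
  ... | no ne with atomic (x ∧ (∸ y)) ne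
  ...   | a , at , a⊑ =
          ⊥-elim (proj₁ (atom⊑∸⇔atom⋢ y at) (⊑-trans a⊑ (∧-lb₂ x (∸ y)))
                                          (atoms⊑ a at (⊑-trans a⊑ (∧-lb₁ x (∸ y)))))

module IdealFacts (𝓜 : IABAIdeal) where
  open IABAIdeal 𝓜
  open AtomicBooleanAlgebra ba

  atom∈I : ∀ a → Atom a → I a
  atom∈I a at = I-finite 1 a (λ _ → a) λ b bt b⊑a → Fin.zero , atom⊑atom⇒≡ b bt b⊑a
    where
    atom⊑atom⇒≡ : ∀ b → Atom b → b ⊑ a → b ≡ a
    atom⊑atom⇒≡ b (b≢𝟘 , _) b⊑a = Sum.[ (λ b≡𝟘 → ⊥-elim (b≢𝟘 b≡𝟘)) , (λ b≡a → b≡a) ]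
                                        (proj₂ at b b⊑a)

  I⇒∸≢𝟘 : ∀ x → I x → (∸ x) ≢ 𝟘
  I⇒∸≢𝟘 x Ix ∸x≡𝟘 = I-¬𝟙 (subst I (compl-∨ x) (I-∨ x (∸ x) Ix (subst I (sym ∸x≡𝟘) I-𝟘)))

module AtomMembership (𝓜 : IABAIdeal) (f : IABAIdeal.M 𝓜 → IABAIdeal.M 𝓜)
                      (bij : IsBijectionIA 𝓜 f) where
  open IABAIdeal 𝓜
  open AtomicBooleanAlgebra ba
  open IdealFacts 𝓜

  _∈*_ : M → M → Set
  x ∈* y = _∈*[_]_ 𝓜 x f y

  open ClassTheory M I _∈*_

  private
    f-atom : ∀ x → I x → Atom (f x)
    f-atom = proj₁ bij

    f-injective : ∀ x y → I x → I y → f x ≡ f y → x ≡ y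
    f-injective = proj₁ (proj₂ bij)

    f-onto : ∀ a → Atom a → Σ M (λ x → I x × (f x ≡ a))
    f-onto = proj₂ (proj₂ bij)

  ∈*-∨ : ∀ {z} x y → I z → (z ∈* (x ∨ y)) iff ((z ∈* x) ⊎ (z ∈* y))
  ∈*-∨ x y Iz .proj₁ (_ , p) = Sum.map (Iz ,_) (Iz ,_) (atom⊑∨ x y (f-atom _ Iz) p)
  ∈*-∨ x y Iz .proj₂ (inj₁ (_ , p)) = Iz , ⊑-trans p (∨-ub₁ x y)
  ∈*-∨ x y Iz .proj₂ (inj₂ (_ , p)) = Iz , ⊑-trans p (∨-ub₂ x y)

  ∈*-∧ : ∀ {z} x y → I z → (z ∈* (x ∧ y)) iff ((z ∈* x) × (z ∈* y))
  ∈*-∧ x y Iz .proj₁ (_ , p) = (Iz , ⊑-trans p (∧-lb₁ x y)) , (Iz , ⊑-trans p (∧-lb₂ x y))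
  ∈*-∧ x y Iz .proj₂ ((_ , p) , (_ , q)) = Iz , ∧-glb p q

  ∈*-∸ : ∀ {z} x → I z → (z ∈* (∸ x)) iff ¬ (z ∈* x)
  ∈*-∸ x Iz .proj₁ (_ , p) (_ , q) = proj₁ (atom⊑∸⇔atom⋢ x (f-atom _ Iz)) p q
  ∈*-∸ x Iz .proj₂ z∉x = Iz , proj₂ (atom⊑∸⇔atom⋢ x (f-atom _ Iz)) (λ p → z∉x (Iz , p))

  ∈*-f : ∀ {z y} → I z → I y → (z ∈* f y) iff (z ≡ y)
  ∈*-f {z} {y} Iz Iy .proj₁ (_ , p) =
    Sum.[ (λ fz≡𝟘 → ⊥-elim (proj₁ (f-atom z Iz) fz≡𝟘)) , f-injective z y Iz Iy ]
        (proj₂ (f-atom y Iy) (f z) p)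
  ∈*-f Iz Iy .proj₂ refl = Iz , ⊑-refl _

  ∉*-𝟘 : ∀ z → ¬ (z ∈* 𝟘)
  ∉*-𝟘 z (Iz , p) = proj₁ (f-atom z Iz) (⊑-antisym p (𝟘-least _))

  ⊑⇒⊆ : ∀ X Y → X ⊑ Y → X ⊆ Y
  ⊑⇒⊆ X Y p z _ (Iz , q) = Iz , ⊑-trans q p

  ⊆⇒⊑ : ExcludedMiddle 0ℓ → ∀ X Y → X ⊆ Y → X ⊑ Y
  ⊆⇒⊑ em X Y X⊆Y = ⊑-by-atoms em X Y atoms⊑
    where
    atoms⊑ : ∀ a → Atom a → a ⊑ X → a ⊑ Y
    atoms⊑ a at a⊑X with f-onto a at
    ... | z , Iz , refl = proj₂ (X⊆Y z Iz (Iz , a⊑X))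

  ∃-set-∉* : ∀ x → I x → Σ M (λ y → I y × ¬ (y ∈* x))
  ∃-set-∉* x Ix with atomic (∸ x) (I⇒∸≢𝟘 x Ix)
  ... | a , at , a⊑∸x with f-onto a at
  ...   | y , Iy , refl = y , Iy , λ y∈x → proj₁ (∈*-∸ x Iy) (Iy , a⊑∸x) y∈x

  bac : ExcludedMiddle 0ℓ → BAC
  bac em = record
    { mem = λ X Y X∈Y → proj₁ X∈Y
    ; subset = λ x X Ix X⊆x → I-down x X (⊆⇒⊑ em X x X⊆x) Ix
    ; emp = 𝟘 , I-𝟘 , λ z _ → ∉*-𝟘 z
    ; adj = λ x y Ix Iy → (x ∨ f y) , I-∨ x (f y) Ix (atom∈I (f y) (f-atom y Iy))
                        , λ z Iz → iff-trans (∈*-∨ x (f y) Iz)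
                                             (⊎-cong-iff iff-refl (∈*-f Iz Iy))
    ; cext = λ X Y X≈Y → ⊑-antisym (⊆⇒⊑ em X Y (λ z Iz → proj₁ (X≈Y z Iz)))
                                   (⊆⇒⊑ em Y X (λ z Iz → proj₂ (X≈Y z Iz)))
    ; union = λ x y Ix Iy → (x ∨ y) , I-∨ x y Ix Iy , λ z → ∈*-∨ x y
    ; ub = ∃-set-∉*
    ; cunion = λ X Y → (X ∨ Y) , λ z → ∈*-∨ X Y
    ; cintersection = λ X Y → (X ∧ Y) , λ z → ∈*-∧ X Y
    ; ccomp = λ X → (∸ X) , λ z → ∈*-∸ X
    }

  sep : Sep
  sep X ¬IX with I-split X ¬IX
  ... | y , y⊑X , ¬Iy , ¬I[X∧∸y] =
        y , (X ∧ (∸ y)) , ⊑⇒⊆ y X y⊑X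
      , (λ z Iz → iff-trans (∈*-∧ X (∸ y) Iz) (×-cong-iff iff-refl (∈*-∸ y Iz)))
      , ¬Iy , ¬I[X∧∸y]

mainTheorem18 : ExcludedMiddle 0ℓ → (𝓜 : IABAIdeal) → (f : IABAIdeal.M 𝓜 → IABAIdeal.M 𝓜) → IsBijectionIA 𝓜 f → ClassTheory.BAC⁺ (IABAIdeal.M 𝓜) (IABAIdeal.I 𝓜) (λ x y → _∈*[_]_ 𝓜 x f y) × (∀ X Y → ClassTheory._⊆_ (IABAIdeal.M 𝓜) (IABAIdeal.I 𝓜) (λ x y → _∈*[_]_ 𝓜 x f y) X Y iff IABAIdeal._⊑_ 𝓜 X Y)
mainTheorem18 em 𝓜 f bij =
  record { bac = bac em ; sep = sep } , λ X Y → ⊆⇒⊑ em X Y , ⊑⇒⊆ X Y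
  where open AtomMembership 𝓜 f bij
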